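{- Let $f:\widetilde{G}\to G$ be a graph morphism. Then $f$ is a homotopy covering map if and only if $f$ is a covering map and the induced functor $\Pi(f):\Pi(\widetilde G)\to\Pi(G)$ is a covering of groupoids, i.e. for every vertex $\tilde v$ of $\widetilde G$ the induced map of stars $\Pi_{\tilde v}(\widetilde G)\to\Pi_{f(\tilde v)}(G)$ is a bijection.
   Context: All graphs are undirected, have no multiple edges, may have loops, are connected, and are not a single isolated vertex. Adjacency is written $x\sim y$ and $N(v)$ is the set of vertices adjacent to $v$. A graph morphism preserves adjacency. A walk of length $n$ is a sequence $(v_0\cdots v_n)$ with $v_i\sim v_{i+1}$; $N_2(v)$ is the set of walks of length 2 starting at $v$. A covering map is a morphism $f:\widetilde G\to G$, surjective on vertices, such that for every vertex $\tilde v$ of $\widetilde G$, $f$ restricts to a bijection $N(\tilde v)\to N(f(\tilde v))$. A homotopy covering map is a morphism $f:\widetilde G\to G$ such that for every vertex $\tilde v$, applying $f$ vertexwise gives a bijection $N_2(\tilde v)\to N_2(f(\tilde v))$ which respects endpoints (two walks in $N_2(\tilde v)$ end at the same vertex iff their images do). A prune of a walk $(v_0\cdots v_n)$ with $v_i=v_{i+2}$ is the walk $(v_0\cdots v_iv_{i+3}\cdots v_n)$ (the segment $v_iv_{i+1}v_i$ replaced by $v_i$). A spider move on a walk $(v_0\cdots v_n)$ replaces one vertex $v_i$ with $0<i<n$ by a vertex $v_i'$ with $v_{i-1}\sim v_i'\sim v_{i+1}$ (these generate homotopy rel endpoints of walks). Two walks from $v$ to $w$ are equivalent if they are connected by a finite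 sequence of prunes, inverse prunes and spider moves. The fundamental groupoid $\Pi(G)$ has objects the vertices of $G$, arrows from $v$ to $w$ the equivalence classes of walks from $v$ to $w$, and composition given by concatenation. The star $\Pi_v(G)$ is the set of arrows with source $v$. A morphism $f$ induces the functor $\Pi(f)$ by applying $f$ to walks. -}

module Defs where

open import Level using (Level; _⊔_) renaming (suc to lsuc)
open import Data.Product using (Σ; ∃; ∃-syntax; _×_; _,_)
open import Relation.Binary.PropositionalEquality using (_≡_; subst)
open import Relation.Binary.Construct.Closure.Equivalence using (EqClosure)

-- A graph: undirected (symmetric adjacency), loops allowed, no multiple
-- edges (adjacency is proof-irrelevant).
record Graph (v e : Level) : Set (lsuc (v ⊔ e)) where
  field
    V      : Set v
    _∼_    : V → V → Set e
    ∼-sym  : ∀ {x y} → x ∼ y → y ∼ x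
    ∼-prop : ∀ {x y} (p q : x ∼ y) → p ≡ q

module _ {v e : Level} (G : Graph v e) where
  open Graph G

  data Walk : V → V → Set (v ⊔ e) where
    []  : ∀ {x} → Walk x x
    _∷_ : ∀ {x y z} → x ∼ y → Walk y z → Walk x z

  infixr 5 _∷_ _++_

  _++_ : ∀ {x y z} → Walk x y → Walk y z → Walk x z
  [] ++ q = q
  (a ∷ p) ++ q = a ∷ (p ++ q)

  Connected : Set (v ⊔ e)
  Connected = ∀ (x y : V) → Walk x y

  NotIsolatedPoint : Set (v ⊔ e)
  NotIsolatedPoint = ∃[ x ] ∃[ y ] (x ∼ y)

  data Step : ∀ {x y} → Walk x y → Walk x y → Set (v ⊔ e) where
    prune  : ∀ {x a b y} (p : Walk x a) (e₁ : a ∼ b) (e₂ : b ∼ a) (q : Walk a y) →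
             Step (p ++ e₁ ∷ e₂ ∷ q) (p ++ q)
    spider : ∀ {x a b b' c y} (p : Walk x a) (e₁ : a ∼ b) (e₂ : b ∼ c)
               (e₁' : a ∼ b') (e₂' : b' ∼ c) (q : Walk c y) →
             Step (p ++ e₁ ∷ e₂ ∷ q) (p ++ e₁' ∷ e₂' ∷ q)

  WalkEquiv : ∀ {x y} → Walk x y → Walk x y → Set (v ⊔ e)
  WalkEquiv {x} {y} = EqClosure (Step {x} {y})

  -- the star Π_x(G): walks from x, up to equivalence (as a setoid)
  Star : V → Set (v ⊔ e)
  Star x = Σ V (Walk x)

  StarEq : ∀ {x} → Star x → Star x → Set (v ⊔ e)
  StarEq {x} (y , p) (y' , p') = Σ (y ≡ y') λ eq → WalkEquiv (subst (Walk x) eq p) p'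

record Morphism {v₁ e₁ v₂ e₂ : Level} (H : Graph v₁ e₁) (G : Graph v₂ e₂)
       : Set (v₁ ⊔ e₁ ⊔ v₂ ⊔ e₂) where
  private
    module H = Graph H
    module G = Graph G
  field
    fun : H.V → G.V
    hom : ∀ {x y} → x H.∼ y → fun x G.∼ fun y

module _ {v₁ e₁ v₂ e₂ : Level} {H : Graph v₁ e₁} {G : Graph v₂ e₂}
         (f : Morphism H G) where
  private
    module H = Graph H
    module G = Graph G
  open Morphism f

  IsCoveringMap : Set (v₁ ⊔ e₁ ⊔ v₂ ⊔ e₂)
  IsCoveringMap =
    (∀ (y : G.V) → ∃[ x ] (fun x ≡ y))
    × (∀ (x : H.V) →
        (∀ {w₁ w₂} → x H.∼ w₁ → x H.∼ w₂ → fun w₁ ≡ fun w₂ → w₁ ≡ w₂)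
        × (∀ {u} → fun x G.∼ u → ∃[ w ] (x H.∼ w × fun w ≡ u)))

  -- N₂(x) → N₂(f x), (x u w) ↦ (f x, f u, f w), is a bijection respecting endpoints
  IsHomotopyCoveringMap : Set (v₁ ⊔ e₁ ⊔ v₂ ⊔ e₂)
  IsHomotopyCoveringMap = ∀ (x : H.V) →
    (∀ {u₁ w₁ u₂ w₂} → x H.∼ u₁ → u₁ H.∼ w₁ → x H.∼ u₂ → u₂ H.∼ w₂ →
       fun u₁ ≡ fun u₂ → fun w₁ ≡ fun w₂ → (u₁ ≡ u₂ × w₁ ≡ w₂))
    × (∀ {u w} → fun x G.∼ u → u G.∼ w →
         ∃[ u' ] ∃[ w' ] (x H.∼ u' × u' H.∼ w' × fun u' ≡ u × fun w' ≡ w))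
    × (∀ {u₁ w₁ u₂ w₂} → x H.∼ u₁ → u₁ H.∼ w₁ → x H.∼ u₂ → u₂ H.∼ w₂ →
         (w₁ ≡ w₂ → fun w₁ ≡ fun w₂) × (fun w₁ ≡ fun w₂ → w₁ ≡ w₂))

  mapWalk : ∀ {x y} → Walk H x y → Walk G (fun x) (fun y)
  mapWalk [] = []
  mapWalk (a ∷ p) = hom a ∷ mapWalk p

  mapStar : ∀ {x} → Star H x → Star G (fun x)
  mapStar (y , p) = fun y , mapWalk p

  IsGroupoidCovering : Set (v₁ ⊔ e₁ ⊔ v₂ ⊔ e₂)
  IsGroupoidCovering = ∀ (x : H.V) →
    (∀ (s t : Star H x) → StarEq G (mapStar s) (mapStar t) → StarEq H s t)
    × (∀ (r : Star G (fun x)) → ∃[ s ] StarEq G (mapStar s) r)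

-- A homotopy covering map is bijective on neighbourhoods, so every walk in G from f x lifts
-- uniquely to a walk in H from x, and lifting is inverse to Π(f) on stars.  Respect of endpoints
-- says that two 2-walks from x whose images end together already end together; hence the lift of
-- a spider move (or of a prune) is again a spider move (a prune), so lifting respects homotopy and
-- Π(f) is bijective on stars.  Conversely, two 2-walks from x whose images end together are related
-- by one spider move in G, so injectivity on stars makes their endpoints coincide.

module Submission where

open import Defs
open import Level using (Level; _⊔_)
open import Data.Product using (_×_; ∃-syntax; _,_; proj₁; proj₂; uncurry)
open import Function.Bundles using (_⇔_; mk⇔)
open import Relation.Binary.PropositionalEquality
  using (_≡_; refl; cong; cong₂; subst₂)
open import Relation.Binary.Construct.Closure.Equivalence
  using (symmetric; transitive; gfold; gmap; return)
open import Relation.Binary.Construct.Closure.ReflexiveTransitive using (ε)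
open import Relation.Binary.Structures using (IsEquivalence)

module _ {v e : Level} (G : Graph v e) where
  open Graph G

  StarEq-refl : ∀ {x} {s : Star G x} → StarEq G s s
  StarEq-refl = refl , ε

  StarEq-sym : ∀ {x} {s t : Star G x} → StarEq G s t → StarEq G t s
  StarEq-sym (refl , r) = refl , symmetric (Step G) r

  StarEq-trans : ∀ {x} {s t u : Star G x} → StarEq G s t → StarEq G t u → StarEq G s u
  StarEq-trans (refl , r) (refl , r') = refl , transitive (Step G) r r'

  StarEq-isEquivalence : ∀ {x} → IsEquivalence (StarEq G {x})
  StarEq-isEquivalence = record { refl = StarEq-refl ; sym = StarEq-sym ; trans = StarEq-trans }

  ≡⇒StarEq : ∀ {x} {s t : Star G x} → s ≡ t → StarEq G s t
  ≡⇒StarEq refl = StarEq-refl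

  consStar : ∀ {x w} → x ∼ w → Star G w → Star G x
  consStar b (y , p) = y , b ∷ p

  consStar-cong : ∀ {x w} (b : x ∼ w) {s t : Star G w} →
                  StarEq G s t → StarEq G (consStar b s) (consStar b t)
  consStar-cong b (refl , r) = refl , gmap (b ∷_) step-cons r
    where
    step-cons : ∀ {y} {p q : Walk G _ y} → Step G p q → Step G (b ∷ p) (b ∷ q)
    step-cons (prune p e₁ e₂ q) = prune (b ∷ p) e₁ e₂ q
    step-cons (spider p e₁ e₂ e₁' e₂' q) = spider (b ∷ p) e₁ e₂ e₁' e₂' q

  consStar-prune : ∀ {x b} (e₁ : x ∼ b) (e₂ : b ∼ x) (s : Star G x) →
                   StarEq G (consStar e₁ (consStar e₂ s)) s
  consStar-prune e₁ e₂ (_ , p) = refl , return (prune [] e₁ e₂ p)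

  consStar-spider : ∀ {x b b' c} (e₁ : x ∼ b) (e₂ : b ∼ c) (e₁' : x ∼ b') (e₂' : b' ∼ c)
                    (s : Star G c) →
                    StarEq G (consStar e₁ (consStar e₂ s)) (consStar e₁' (consStar e₂' s))
  consStar-spider e₁ e₂ e₁' e₂' (_ , p) = refl , return (spider [] e₁ e₂ e₁' e₂' p)

  spider-StarEq : ∀ {x b b' c c'} (e₁ : x ∼ b) (e₂ : b ∼ c) (e₁' : x ∼ b') (e₂' : b' ∼ c') →
                  c ≡ c' → StarEq G (c , e₁ ∷ e₂ ∷ []) (c' , e₁' ∷ e₂' ∷ [])
  spider-StarEq e₁ e₂ e₁' e₂' refl = consStar-spider e₁ e₂ e₁' e₂' (_ , [])

  data HeadStep : ∀ {x y} → Walk G x y → Walk G x y → Set (v ⊔ e) where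
    prune  : ∀ {x b y} (e₁ : x ∼ b) (e₂ : b ∼ x) (q : Walk G x y) →
             HeadStep (e₁ ∷ e₂ ∷ q) q
    spider : ∀ {x b b' c y} (e₁ : x ∼ b) (e₂ : b ∼ c) (e₁' : x ∼ b') (e₂' : b' ∼ c)
               (q : Walk G c y) →
             HeadStep (e₁ ∷ e₂ ∷ q) (e₁' ∷ e₂' ∷ q)

module HomotopyCoveringLifting {v₁ e₁ v₂ e₂ : Level} {H : Graph v₁ e₁} {G : Graph v₂ e₂}
       (f : Morphism H G) (hc : IsHomotopyCoveringMap f) where
  private
    module H = Graph H
    module G = Graph G
  open Morphism f

  liftEdge : ∀ x {u} → fun x G.∼ u → ∃[ w ] (x H.∼ w × fun w ≡ u)
  liftEdge x e with proj₁ (proj₂ (hc x)) e (G.∼-sym e)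
  ... | w , _ , b , _ , eq , _ = w , b , eq

  neighbour-injective : ∀ x {w₁ w₂} → x H.∼ w₁ → x H.∼ w₂ → fun w₁ ≡ fun w₂ → w₁ ≡ w₂
  neighbour-injective x b₁ b₂ eq = proj₁ (proj₁ (hc x) b₁ (H.∼-sym b₁) b₂ (H.∼-sym b₂) eq refl)

  endpoint-injective : ∀ x {u₁ w₁ u₂ w₂} → x H.∼ u₁ → u₁ H.∼ w₁ → x H.∼ u₂ → u₂ H.∼ w₂ →
                       fun w₁ ≡ fun w₂ → w₁ ≡ w₂
  endpoint-injective x a₁ b₁ a₂ b₂ = proj₂ (proj₂ (proj₂ (hc x)) a₁ b₁ a₂ b₂)

  liftWalk : ∀ x {z} → Walk G (fun x) z → Star H x
  liftWalk x [] = x , []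
  liftWalk x (e ∷ r) with liftEdge x e
  ... | w , b , refl = consStar H b (liftWalk w r)

  mapStar-liftWalk : ∀ x {z} (r : Walk G (fun x) z) → mapStar f (liftWalk x r) ≡ (z , r)
  mapStar-liftWalk x [] = refl
  mapStar-liftWalk x (e ∷ r) with liftEdge x e
  ... | w , b , refl = cong₂ (consStar G) (G.∼-prop _ _) (mapStar-liftWalk w r)

  liftWalk-mapWalk : ∀ x {y} (s : Walk H x y) → liftWalk x (mapWalk f s) ≡ (y , s)
  liftWalk-mapWalk x [] = refl
  -- Matching eq : fun w ≡ fun w against refl relies on K (enabled by default).
  liftWalk-mapWalk x (a ∷ s) with liftEdge x (hom a)
  ... | w , b , eq with neighbour-injective x b a eq
  ... | refl with eq | H.∼-prop a b
  ... | refl | refl = cong (consStar H a) (liftWalk-mapWalk w s)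

  liftWalk-headStep : ∀ x {z} {r r' : Walk G (fun x) z} → HeadStep G r r' →
                      StarEq H (liftWalk x r) (liftWalk x r')
  liftWalk-headStep x (prune e₁ e₂ q) with liftEdge x e₁
  ... | w₁ , b₁ , refl with liftEdge w₁ e₂
  ... | w₂ , b₂ , eq with endpoint-injective x b₁ b₂ b₁ (H.∼-sym b₁) eq
  ... | refl with eq
  ... | refl = consStar-prune H b₁ b₂ (liftWalk x q)
  liftWalk-headStep x (spider e₁ e₂ e₁' e₂' q) with liftEdge x e₁ | liftEdge x e₁'
  ... | w₁ , b₁ , refl | w₁' , b₁' , refl with liftEdge w₁ e₂
  ... | w₂ , b₂ , refl with liftEdge w₁' e₂'
  ... | w₂' , b₂' , eq with endpoint-injective x b₁' b₂' b₁ b₂ eq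
  ... | refl with eq
  ... | refl = consStar-spider H b₁ b₂ b₁' b₂' (liftWalk w₂ q)

  liftWalk-++ : ∀ x {a z} (p : Walk G (fun x) a) {r r' : Walk G a z} → HeadStep G r r' →
                StarEq H (liftWalk x (_++_ G p r)) (liftWalk x (_++_ G p r'))
  liftWalk-++ x [] m = liftWalk-headStep x m
  liftWalk-++ x (e ∷ p) m with liftEdge x e
  ... | w , b , refl = consStar-cong H b (liftWalk-++ w p m)

  liftWalk-step : ∀ x {z} {r r' : Walk G (fun x) z} → Step G r r' →
                  StarEq H (liftWalk x r) (liftWalk x r')
  liftWalk-step x (prune p e₁ e₂ q) = liftWalk-++ x p (prune e₁ e₂ q)
  liftWalk-step x (spider p e₁ e₂ e₁' e₂' q) = liftWalk-++ x p (spider e₁ e₂ e₁' e₂' q)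

  liftStar : ∀ x → Star G (fun x) → Star H x
  liftStar x (_ , r) = liftWalk x r

  liftStar-cong : ∀ x {r r' : Star G (fun x)} → StarEq G r r' →
                  StarEq H (liftStar x r) (liftStar x r')
  liftStar-cong x (refl , rr') = gfold (StarEq-isEquivalence H) (liftWalk x) (liftWalk-step x) rr'

  isGroupoidCovering : IsGroupoidCovering f
  isGroupoidCovering x = injective , surjective
    where
    injective : ∀ s t → StarEq G (mapStar f s) (mapStar f t) → StarEq H s t
    injective (_ , s) (_ , t) st =
      subst₂ (StarEq H) (liftWalk-mapWalk x s) (liftWalk-mapWalk x t) (liftStar-cong x st)
    surjective : ∀ r → ∃[ s ] StarEq G (mapStar f s) r
    surjective (_ , r) = liftWalk x r , ≡⇒StarEq G (mapStar-liftWalk x r)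

  isCoveringMap : Connected G → H.V → IsCoveringMap f
  isCoveringMap connected x₀ = vertex-surjective , λ x → neighbour-injective x , liftEdge x
    where
    vertex-surjective : ∀ y → ∃[ x ] (fun x ≡ y)
    vertex-surjective y = proj₁ (liftWalk x₀ r) , cong proj₁ (mapStar-liftWalk x₀ r)
      where r = connected (fun x₀) y

module _ {v₁ e₁ v₂ e₂ : Level} {H : Graph v₁ e₁} {G : Graph v₂ e₂} {f : Morphism H G} where
  private
    module H = Graph H
    module G = Graph G
  open Morphism f

  covering⇒homotopyCovering : IsCoveringMap f → IsGroupoidCovering f → IsHomotopyCoveringMap f
  covering⇒homotopyCovering (_ , local) groupoid x = injective , surjective , endpoints
    where
    injective : ∀ {u₁ w₁ u₂ w₂} → x H.∼ u₁ → u₁ H.∼ w₁ → x H.∼ u₂ → u₂ H.∼ w₂ →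
                fun u₁ ≡ fun u₂ → fun w₁ ≡ fun w₂ → u₁ ≡ u₂ × w₁ ≡ w₂
    injective a₁ b₁ a₂ b₂ eu ew with proj₁ (local x) a₁ a₂ eu
    ... | refl = refl , proj₁ (local _) b₁ b₂ ew

    surjective : ∀ {u w} → fun x G.∼ u → u G.∼ w →
                 ∃[ u' ] ∃[ w' ] (x H.∼ u' × u' H.∼ w' × fun u' ≡ u × fun w' ≡ w)
    surjective e e' with proj₂ (local x) e
    ... | u' , a , refl with proj₂ (local u') e'
    ... | w' , b , eq = u' , w' , a , b , refl , eq

    endpoints : ∀ {u₁ w₁ u₂ w₂} → x H.∼ u₁ → u₁ H.∼ w₁ → x H.∼ u₂ → u₂ H.∼ w₂ →
                (w₁ ≡ w₂ → fun w₁ ≡ fun w₂) × (fun w₁ ≡ fun w₂ → w₁ ≡ w₂)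
    endpoints {w₁ = w₁} {w₂ = w₂} a₁ b₁ a₂ b₂ = cong fun , λ eq →
      proj₁ (proj₁ (groupoid x) (w₁ , a₁ ∷ b₁ ∷ []) (w₂ , a₂ ∷ b₂ ∷ [])
              (spider-StarEq G (hom a₁) (hom b₁) (hom a₂) (hom b₂) eq))

proposition3p12 : ∀ {v₁ e₁ v₂ e₂ : Level} (H : Graph v₁ e₁) (G : Graph v₂ e₂)
    → Connected H → NotIsolatedPoint H
    → Connected G → NotIsolatedPoint G
    → (f : Morphism H G)
    → IsHomotopyCoveringMap f ⇔ (IsCoveringMap f × IsGroupoidCovering f)
proposition3p12 H G _ (x₀ , _) connected _ f =
  mk⇔ (λ hc → let open HomotopyCoveringLifting f hc
              in isCoveringMap connected x₀ , isGroupoidCovering)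
      (uncurry covering⇒homotopyCovering)
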